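{- Let $a,b$ be propositional variables, let $\varphi=a\,\mathsf{S}\,b$, and let $r$ be the dynamic rule $q_1,q_2\;{:}{ - }\;\mathcal{S}(a,b)$. Then for every interpretation $I$ and time point $t\ge 1$, $(I,t)\models\varphi$ if and only if $(r,I,t)\models q_2$.
   Context: Interpretations are finite non-empty sequences $I=I_1,\dots,I_\ell$ of subsets of $\{a,b\}$. Past LTL semantics: $(I,t)\models x$ iff $x\in I_t$ for a variable $x$; $(I,t)\models\alpha\,\mathsf{S}\,\beta$ iff there is $j\in[1,t]$ with $(I,j)\models\beta$ and $(I,k)\models\alpha$ for all $k\in[j+1,t]$. The since operator automaton is $\mathcal{S}=\langle\{0,1\}^2,\{1,2\},\delta,1\rangle$, with letters $xy$ giving the values of $(a,b)$, and $\delta(q,10)=q$, $\delta(q,01)=\delta(q,11)=2$, $\delta(q,00)=1$. Semantics of the rule: $(r,I,t)\models a$ iff $a\in I_t$ (similarly $b$); $(r,I,0)\models q_i$ iff $i=1$; for $t>0$, $(r,I,t)\models q_i$ iff there are $j\in\{1,2\}$ and an assignment $\sigma\in\{0,1\}^2$ to $(a,b)$ with $\delta(j,\sigma)=i$, $(r,I,t-1)\models q_j$ and $(r,I,t)\models\sigma$ (the assignment read as the conjunction of literals it makes true). -}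

module Defs where

open import Data.Nat using (ℕ; zero; suc; _≤_; _<_)
open import Data.Fin using (Fin; fromℕ<)
open import Data.Bool using (Bool; true; false)
open import Data.Product using (_×_; _,_; Σ; ∃-syntax)
open import Relation.Binary.PropositionalEquality using (_≡_)

data Var : Set where
  a b : Var

Valuation : Set
Valuation = Var → Bool

-- An interpretation: a finite non-empty sequence I_1 … I_ℓ of subsets of {a,b}.
-- Represented by its length ℓ (with 1 ≤ ℓ) and the map Fin ℓ → Valuation,
-- where position t ∈ [1,ℓ] is stored at index t-1.
record Interpretation : Set where
  field
    len      : ℕ
    nonEmpty : 1 ≤ len
    val      : Fin len → Valuation
open Interpretation public

_∈I_at_ : Var → (I : Interpretation) → ℕ → Set
x ∈I I at zero = Data.Empty.⊥  -- time 0 is not a position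
  where import Data.Empty
x ∈I I at suc t = Σ (suc t ≤ len I) λ p → val I (fromℕ< p) x ≡ true

data Formula : Set where
  var : Var → Formula
  _S_ : Formula → Formula → Formula

_,_⊨_ : Interpretation → ℕ → Formula → Set
I , t ⊨ var x = x ∈I I at t
I , t ⊨ (α S β) =
  ∃[ j ] ((1 ≤ j × j ≤ t) × (I , j ⊨ β) ×
          ((k : ℕ) → suc j ≤ k → k ≤ t → I , k ⊨ α))

-- The since operator automaton 𝒮 = ⟨{0,1}², {1,2}, δ, 1⟩.
-- Letters xy give values of (a,b).
data State : Set where
  q₁ q₂ : State

Letter : Set
Letter = Bool × Bool

δ : State → Letter → State
δ q (true  , false) = q
δ q (false , true ) = q₂
δ q (true  , true ) = q₂
δ q (false , false) = q₁

lit : Interpretation → ℕ → Var → Bool → Set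
lit I t x true  = x ∈I I at t
lit I t x false = x ∈I I at t → Data.Empty.⊥
  where import Data.Empty

_at_⊨ₗ_ : Interpretation → ℕ → Letter → Set
I at t ⊨ₗ (x , y) = lit I t a x × lit I t b y

RuleHolds : Interpretation → ℕ → State → Set
RuleHolds I zero q₁ = Data.Unit.⊤
  where import Data.Unit
RuleHolds I zero q₂ = Data.Empty.⊥
  where import Data.Empty
RuleHolds I (suc t) i =
  ∃[ j ] ∃[ σ ] (δ j σ ≡ i × RuleHolds I t j × I at suc t ⊨ₗ σ)

φ : Formula
φ = var a S var b

{-# OPTIONS --safe #-}
module Submission where

-- The automaton 𝒮 is deterministic, so at each time point the rule's
-- semantics singles out exactly one state: the run of 𝒮 on the letters
-- (does a hold?, does b hold?) read so far.  Its transition into q₂ says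
-- "b now, or a now and q₂ before", which is precisely the one-step
-- unfolding  α S β ⇔ β ∨ (α ∧ ● (α S β))  of the since operator; an
-- induction on time then identifies "the run is in q₂" with a S b.

open import Defs
open import Data.Bool using (true; false)
import Data.Bool as Bool
open import Data.Empty using (⊥-elim)
open import Data.Fin using (fromℕ<)
open import Data.Nat using (ℕ; zero; suc; _≤_; s≤s; z≤n; _≤?_)
open import Data.Nat.Properties using (≤-refl; ≤-trans; m≤n⇒m≤1+n; m≤n⇒m<n∨m≡n; 1+n≰n; ≤-irrelevant)
open import Data.Product using (_×_; _,_; proj₁)
open import Data.Product.Function.NonDependent.Propositional using (_×-⇔_)
open import Data.Sum using (_⊎_; inj₁; inj₂)
open import Data.Sum.Function.Propositional using (_⊎-⇔_)
open import Data.Unit using (tt)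
open import Function using (_∘_)
open import Function.Bundles using (_⇔_; mk⇔; Equivalence)
open import Function.Properties.Equivalence using (sym; trans)
open import Function.Related.Propositional using (module EquationalReasoning)
open import Relation.Nullary using (¬_; Dec; yes; no; does)
open import Relation.Nullary.Decidable using (map′; dec-true)
open import Relation.Binary.PropositionalEquality as ≡ using (_≡_; cong₂; subst)

since-at-zero : ∀ {I α β} → ¬ (I , 0 ⊨ (α S β))
since-at-zero (j , (1≤j , j≤0) , _) = 1+n≰n (≤-trans 1≤j j≤0)

since-unfold : ∀ {I α β} t →
  (I , suc t ⊨ (α S β)) ⇔ ((I , suc t ⊨ β) ⊎ ((I , suc t ⊨ α) × (I , t ⊨ (α S β))))
since-unfold {I} {α} {β} t = mk⇔ to from
  where
  to : I , suc t ⊨ (α S β) → (I , suc t ⊨ β) ⊎ ((I , suc t ⊨ α) × (I , t ⊨ (α S β)))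
  to (j , (1≤j , j≤1+t) , βj , αafter) with m≤n⇒m<n∨m≡n j≤1+t
  ... | inj₂ ≡.refl       = inj₁ βj
  ... | inj₁ (s≤s j≤t) =
    inj₂ (αafter (suc t) (s≤s j≤t) ≤-refl ,
          (j , (1≤j , j≤t) , βj , λ k j<k k≤t → αafter k j<k (m≤n⇒m≤1+n k≤t)))

  from : (I , suc t ⊨ β) ⊎ ((I , suc t ⊨ α) × (I , t ⊨ (α S β))) → I , suc t ⊨ (α S β)
  from (inj₁ βnow) =
    suc t , (s≤s z≤n , ≤-refl) , βnow , λ k t+1<k k≤t+1 → ⊥-elim (1+n≰n (≤-trans t+1<k k≤t+1))
  from (inj₂ (αnow , (j , (1≤j , j≤t) , βj , αafter))) =
    j , (1≤j , m≤n⇒m≤1+n j≤t) , βj , λ k j<k k≤1+t → αupto k j<k (m≤n⇒m<n∨m≡n k≤1+t)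
    where
    αupto : ∀ k → suc j ≤ k → (suc k ≤ suc t) ⊎ (k ≡ suc t) → I , k ⊨ α
    αupto k j<k (inj₁ (s≤s k≤t)) = αafter k j<k k≤t
    αupto k j<k (inj₂ ≡.refl)     = αnow

-- Positions beyond len I are not in I, so membership is decidable without a bound on t.
∈I-dec : ∀ x I t → Dec (x ∈I I at t)
∈I-dec x I zero = no λ ()
∈I-dec x I (suc t) with suc t ≤? len I
... | no  t∉I = no (t∉I ∘ proj₁)
... | yes t∈I = map′ (t∈I ,_) holds (val I (fromℕ< t∈I) x Bool.≟ true)
  where
  holds : x ∈I I at suc t → val I (fromℕ< t∈I) x ≡ true
  holds (t∈I′ , x∈) = subst (λ p → val I (fromℕ< p) x ≡ true) (≤-irrelevant t∈I′ t∈I) x∈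

does-true⇔ : ∀ {A : Set} (A? : Dec A) → (does A? ≡ true) ⇔ A
does-true⇔ (yes A) = mk⇔ (λ _ → A) (λ _ → ≡.refl)
does-true⇔ (no ¬A) = mk⇔ (λ ()) (⊥-elim ∘ ¬A)

letter : Interpretation → ℕ → Letter
letter I t = does (∈I-dec a I t) , does (∈I-dec b I t)

lit-does : ∀ I t x → lit I t x (does (∈I-dec x I t))
lit-does I t x with ∈I-dec x I t
... | yes x∈ = x∈
... | no  x∉ = x∉

lit-unique : ∀ I t x v → lit I t x v → v ≡ does (∈I-dec x I t)
lit-unique I t x v l with ∈I-dec x I t | v
... | yes _  | true  = ≡.refl
... | yes x∈ | false = ⊥-elim (l x∈)
... | no  x∉ | true  = ⊥-elim (x∉ l)
... | no  _  | false = ≡.refl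

letter-sat : ∀ I t → I at t ⊨ₗ letter I t
letter-sat I t = lit-does I t a , lit-does I t b

letter-unique : ∀ I t σ → I at t ⊨ₗ σ → σ ≡ letter I t
letter-unique I t (x , y) (lx , ly) = cong₂ _,_ (lit-unique I t a x lx) (lit-unique I t b y ly)

run : Interpretation → ℕ → State
run I zero    = q₁
run I (suc t) = δ (run I t) (letter I (suc t))

RuleHolds⇔run : ∀ I t i → RuleHolds I t i ⇔ (run I t ≡ i)
RuleHolds⇔run I zero q₁ = mk⇔ (λ _ → ≡.refl) (λ _ → tt)
RuleHolds⇔run I zero q₂ = mk⇔ (λ ()) (λ ())
RuleHolds⇔run I (suc t) i = mk⇔ to from
  where
  to : RuleHolds I (suc t) i → run I (suc t) ≡ i
  to (j , σ , δjσ≡i , rule-j , σ-sat)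
    rewrite Equivalence.to (RuleHolds⇔run I t j) rule-j
          | letter-unique I (suc t) σ σ-sat = δjσ≡i

  from : run I (suc t) ≡ i → RuleHolds I (suc t) i
  from run≡i = run I t , letter I (suc t) , run≡i
             , Equivalence.from (RuleHolds⇔run I t (run I t)) ≡.refl
             , letter-sat I (suc t)

δ≡q₂⇔ : ∀ q x y → (δ q (x , y) ≡ q₂) ⇔ ((y ≡ true) ⊎ ((x ≡ true) × (q ≡ q₂)))
δ≡q₂⇔ q true  true  = mk⇔ (λ _ → inj₁ ≡.refl) (λ _ → ≡.refl)
δ≡q₂⇔ q false true  = mk⇔ (λ _ → inj₁ ≡.refl) (λ _ → ≡.refl)
δ≡q₂⇔ q true  false = mk⇔ (λ q≡q₂ → inj₂ (≡.refl , q≡q₂)) λ { (inj₁ ()) ; (inj₂ (_ , q≡q₂)) → q≡q₂ }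
δ≡q₂⇔ q false false = mk⇔ (λ ()) λ { (inj₁ ()) ; (inj₂ (() , _)) }

run≡q₂⇔φ : ∀ I t → (run I t ≡ q₂) ⇔ (I , t ⊨ φ)
run≡q₂⇔φ I zero    = mk⇔ (λ ()) (⊥-elim ∘ since-at-zero)
run≡q₂⇔φ I (suc t) = begin
  (run I (suc t) ≡ q₂)
    ∼⟨ δ≡q₂⇔ (run I t) _ _ ⟩
  ((does (∈I-dec b I (suc t)) ≡ true) ⊎ ((does (∈I-dec a I (suc t)) ≡ true) × (run I t ≡ q₂)))
    ∼⟨ does-true⇔ (∈I-dec b I (suc t)) ⊎-⇔ (does-true⇔ (∈I-dec a I (suc t)) ×-⇔ run≡q₂⇔φ I t) ⟩
  ((b ∈I I at suc t) ⊎ ((a ∈I I at suc t) × (I , t ⊨ φ)))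
    ∼⟨ sym (since-unfold t) ⟩
  (I , suc t ⊨ φ) ∎
  where open EquationalReasoning

lemma5 : (I : Interpretation) (t : ℕ) → 1 ≤ t → t ≤ len I →
         ((I , t ⊨ φ) → RuleHolds I t q₂) × (RuleHolds I t q₂ → (I , t ⊨ φ))
lemma5 I t _ _ = Equivalence.to φ⇔rule , Equivalence.from φ⇔rule
  where
  φ⇔rule : (I , t ⊨ φ) ⇔ RuleHolds I t q₂
  φ⇔rule = sym (trans (RuleHolds⇔run I t q₂) (run≡q₂⇔φ I t))
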